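{- Let $n\ge3$ be odd, $p$ a prime, and $B=p^kB'$, $C=p^\ell C'$ nonzero integers with $k,\ell\ge0$ and $p\nmid B'C'$. If $\ell$ is even, or if $\ell$ is odd and $k\ge n+\ell$, then $\mathcal{Y}_{B,C}(\mathbb{Z}_p)\neq\emptyset$, i.e. there exists a primitive triple $(x,y,z)\in\mathbb{Z}_p^3$ (not all divisible by $p$) with $x^2+By^2=Cz^n$.
   Context: $\mathcal{Y}_{B,C}$ is the quotient stack $[S/\mathbb{G}_m]$ with $S:x^2+By^2=Cz^n$ minus the origin and weights $(n,n,2)$; its $\mathbb{Z}_p$-points correspond to primitive $\mathbb{Z}_p$-solutions. -}

module Defs where

open import Data.Nat as ℕ using (ℕ; suc)
open import Data.Integer using (ℤ; +_; _+_; _-_; _*_; _^_)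
open import Data.Integer.Divisibility using (_∣_)
open import Data.Product using (_×_)
open import Relation.Nullary using (¬_)

_≡_[mod_] : ℤ → ℤ → ℕ → Set
a ≡ b [mod N ] = (+ N) ∣ (a - b)

-- p-adic integers as the inverse limit  lim Z/p^m :
-- a coherent sequence of integer representatives, where  digit m
-- represents the residue class modulo p^m.
record ℤ[_] (p : ℕ) : Set where
  constructor mkℤp
  field
    digit : ℕ → ℤ
    coh   : ∀ m → digit (suc m) ≡ digit m [mod p ℕ.^ m ]
open ℤ[_] public

SolvesIn : (p : ℕ) (B C : ℤ) (n : ℕ) (x y z : ℤ[ p ]) → Set
SolvesIn p B C n x y z =
  ∀ m → (digit x m ^ 2 + B * digit y m ^ 2) ≡ C * digit z m ^ n [mod p ℕ.^ m ]

Primitive : (p : ℕ) (x y z : ℤ[ p ]) → Set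
Primitive p x y z =
  ¬ ((+ p ∣ digit x 1) × (+ p ∣ digit y 1) × (+ p ∣ digit z 1))

module Submission where

open import Defs
open import Data.Nat as ℕ using (ℕ; _≤_; zero; suc)
open import Data.Nat.Base using (nonTrivial⇒≢1)
open import Data.Nat.Primality using (Prime; euclidsLemma; prime⇒nonTrivial)
open import Data.Nat.Divisibility renaming (_∣_ to _∣ℕ_)
  using (divides; _∣0; ∣1⇒≡1; ∣m⇒∣m*n; ∣n⇒∣m*n; ∣m∣n⇒∣m+n; n∣n)
import Data.Nat.Properties as ℕ
open import Data.Nat.Tactic.RingSolver as ℕ-Solver using ()
open import Data.Integer using (ℤ; +_; 0ℤ; 1ℤ; _*_; _^_; _+_; ∣_∣)
open import Data.Integer.Divisibility using (_∣_)
import Data.Integer.Divisibility.Signed as S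
open import Data.Integer.Properties
  using (+-inverseʳ; abs-*; *-assoc; ^-distribˡ-+-*; ^-*-assoc; *-commutativeSemigroup)
open import Data.Integer.Tactic.RingSolver using (solve-∀)
open import Algebra.Properties.CommutativeSemigroup *-commutativeSemigroup using (interchange)
open import Data.Product using (_×_; ∃-syntax; _,_)
open import Data.Sum using (_⊎_; inj₁; inj₂)
open import Function using (_∘_)
open import Relation.Nullary using (¬_; contradiction)
open import Relation.Binary.PropositionalEquality

-- Constant integer solutions suffice. Write n = 2b + 1. If ℓ = 2j, then
-- (p^j C'^(b+1), 0, C') is a solution with p ∤ z. If ℓ is odd, then n + ℓ = 2h
-- is even; write k = n + ℓ + e and choose s with p ∤ W = s² + p^e B'
-- (s = 0 if e = 0, s = 1 otherwise). Multiplying  s² + p^e B' · 1² = W  by the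
-- square u², u = C'^(b+1) W^b, turns the right-hand side into C' (C' W)^n,
-- because n + 1 and n - 1 are even; scaling x by p^h then absorbs p^k and p^ℓ,
-- giving the solution (p^h s u, u, p C' W), which is primitive as p ∤ u.

≡⇒≡[mod] : ∀ {a b : ℤ} N → a ≡ b → a ≡ b [mod N ]
≡⇒≡[mod] {a} N refl = subst (λ t → N ∣ℕ ∣ t ∣) (sym (+-inverseʳ a)) (N ∣0)

fromℤ : ∀ {p} → ℤ → ℤ[ p ]
fromℤ {p} v = mkℤp (λ _ → v) (λ m → ≡⇒≡[mod] {v} (p ℕ.^ m) refl)

PrimitiveSolution : ℕ → ℤ → ℤ → ℕ → Set
PrimitiveSolution p B C n =
  ∃[ x ] ∃[ y ] ∃[ z ] (Primitive p x y z × SolvesIn p B C n x y z)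

integral⇒primitiveSolution : ∀ {p B C n} (x y z : ℤ) →
  ¬ ((+ p ∣ x) × (+ p ∣ y) × (+ p ∣ z)) →
  x ^ 2 + B * y ^ 2 ≡ C * z ^ n → PrimitiveSolution p B C n
integral⇒primitiveSolution {p} x y z not-all-divisible eq =
  fromℤ x , fromℤ y , fromℤ z , not-all-divisible , λ m → ≡⇒≡[mod] (p ℕ.^ m) eq

¬2∣⇒odd : ∀ n → ¬ (2 ∣ℕ n) → ∃[ b ] n ≡ suc (b ℕ.+ b)
¬2∣⇒odd zero 2∤0 = contradiction (2 ∣0) 2∤0
¬2∣⇒odd (suc zero) _ = 0 , refl
¬2∣⇒odd (suc (suc n)) 2∤n+2 with ¬2∣⇒odd n (2∤n+2 ∘ ∣m∣n⇒∣m+n n∣n)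
... | b , refl = suc b , cong (suc ∘ suc) (sym (ℕ.+-suc b b))

odd+odd≡double : ∀ a b → suc (b ℕ.+ b) ℕ.+ suc (a ℕ.+ a) ≡ suc (a ℕ.+ b) ℕ.+ suc (a ℕ.+ b)
odd+odd≡double = ℕ-Solver.solve-∀

^-distrib-* : ∀ x y m → (x * y) ^ m ≡ x ^ m * y ^ m
^-distrib-* x y zero = refl
^-distrib-* x y (suc m) =
  trans (cong (x * y *_) (^-distrib-* x y m)) (interchange x y (x ^ m) (y ^ m))

^-odd : ∀ x b → x ^ suc (b ℕ.+ b) ≡ x * (x ^ b * x ^ b)
^-odd x b = cong (x *_) (^-distribˡ-+-* x b b)

^-suc-square : ∀ x b → (x ^ suc b) ^ 2 ≡ x * x ^ suc (b ℕ.+ b)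
^-suc-square x b = trans (expand x (x ^ b)) (cong (x *_) (sym (^-odd x b)))
  where
  -- The ring solver does not accept _^_, so squares appear unfolded as x * (x * 1ℤ).
  expand : ∀ x g → (x * g) * ((x * g) * 1ℤ) ≡ x * (x * (g * g))
  expand = solve-∀

norm-times-square : ∀ c s E b → let W = s ^ 2 + E ; u = c ^ suc b * W ^ b in
  (s * u) ^ 2 + E * u ^ 2 ≡ c * (c * W) ^ suc (b ℕ.+ b)
norm-times-square c s E b = begin
  (s * (g * v)) ^ 2 + E * (g * v) ^ 2 ≡⟨ factor s E g v ⟩
  g ^ 2 * (W * (v * v))               ≡⟨ cong₂ _*_ (^-suc-square c b) (sym (^-odd W b)) ⟩
  c * c ^ n * W ^ n                   ≡⟨ *-assoc c (c ^ n) (W ^ n) ⟩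
  c * (c ^ n * W ^ n)                 ≡⟨ cong (c *_) (^-distrib-* c W n) ⟨
  c * (c * W) ^ n                     ∎
  where
  open ≡-Reasoning
  n = suc (b ℕ.+ b)
  W = s ^ 2 + E
  g = c ^ suc b
  v = W ^ b
  factor : ∀ s E g v → (s * (g * v)) * ((s * (g * v)) * 1ℤ) + E * ((g * v) * ((g * v) * 1ℤ))
                     ≡ (g * (g * 1ℤ)) * ((s * (s * 1ℤ) + E) * (v * v))
  factor = solve-∀

∤*⇒∤ˡ : ∀ {p} a b → ¬ (+ p ∣ a * b) → ¬ (+ p ∣ a)
∤*⇒∤ˡ {p} a b p∤ab p∣a = p∤ab (subst (p ∣ℕ_) (sym (abs-* a b)) (∣m⇒∣m*n ∣ b ∣ p∣a))

∤*⇒∤ʳ : ∀ {p} a b → ¬ (+ p ∣ a * b) → ¬ (+ p ∣ b)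
∤*⇒∤ʳ {p} a b p∤ab p∣b = p∤ab (subst (p ∣ℕ_) (sym (abs-* a b)) (∣n⇒∣m*n ∣ a ∣ p∣b))

module _ {p : ℕ} (p-prime : Prime p) where

  ∤1 : ¬ (+ p ∣ 1ℤ)
  ∤1 = nonTrivial⇒≢1 {{prime⇒nonTrivial p-prime}} ∘ ∣1⇒≡1

  ∤*∤⇒∤ : ∀ {a b} → ¬ (+ p ∣ a) → ¬ (+ p ∣ b) → ¬ (+ p ∣ a * b)
  ∤*∤⇒∤ {a} {b} p∤a p∤b p∣ab
    with euclidsLemma ∣ a ∣ ∣ b ∣ p-prime (subst (p ∣ℕ_) (abs-* a b) p∣ab)
  ... | inj₁ p∣a = p∤a p∣a
  ... | inj₂ p∣b = p∤b p∣b

  ∤⇒∤^ : ∀ {a} → ¬ (+ p ∣ a) → ∀ m → ¬ (+ p ∣ a ^ m)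
  ∤⇒∤^ p∤a zero    = ∤1
  ∤⇒∤^ {a} p∤a (suc m) = ∤*∤⇒∤ {a} {a ^ m} p∤a (∤⇒∤^ {a} p∤a m)

  ∃[s]∤s²+p^eB : ∀ {B} → ¬ (+ p ∣ B) → ∀ e → ∃[ s ] ¬ (+ p ∣ s ^ 2 + (+ p) ^ e * B)
  ∃[s]∤s²+p^eB {B} p∤B zero = 0ℤ , p∤B ∘ subst (+ p ∣_) (0²+1*B≡B B)
    where
    0²+1*B≡B : ∀ B → 0ℤ * (0ℤ * 1ℤ) + 1ℤ * B ≡ B
    0²+1*B≡B = solve-∀
  ∃[s]∤s²+p^eB {B} p∤B (suc e) =
    1ℤ , λ p∣1+pX → ∤1 (S.∣⇒∣ᵤ (S.∣m+n∣n⇒∣m {+ p} {1ℤ} (S.∣ᵤ⇒∣ p∣1+pX) p∣pX))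
    where
    p∣pX : + p S.∣ + p * (+ p) ^ e * B
    p∣pX = S.∣m⇒∣m*n B (S.∣m⇒∣m*n ((+ p) ^ e) S.∣-refl)

even-valuation-solution : ∀ {p} b k j B' C' → ¬ (+ p ∣ C') →
  PrimitiveSolution p ((+ p) ^ k * B') ((+ p) ^ (j ℕ.* 2) * C') (suc (b ℕ.+ b))
even-valuation-solution {p} b k j B' C' p∤C' =
  integral⇒primitiveSolution {p} {K} {Q * C'} {n} (P * C' ^ suc b) 0ℤ C'
    (λ (_ , _ , p∣C') → p∤C' p∣C') (begin
    (P * C' ^ suc b) ^ 2 + K * 0ℤ ^ 2  ≡⟨ square-of-product P (C' ^ suc b) K ⟩
    P ^ 2 * (C' ^ suc b) ^ 2           ≡⟨ cong₂ _*_ (^-*-assoc (+ p) j 2) (^-suc-square C' b) ⟩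
    Q * (C' * C' ^ n)                  ≡⟨ *-assoc Q C' (C' ^ n) ⟨
    Q * C' * C' ^ n                    ∎)
  where
  open ≡-Reasoning
  n = suc (b ℕ.+ b)
  P = (+ p) ^ j
  Q = (+ p) ^ (j ℕ.* 2)
  K = (+ p) ^ k * B'
  square-of-product : ∀ P G K → (P * G) * ((P * G) * 1ℤ) + K * (0ℤ * (0ℤ * 1ℤ))
                              ≡ (P * (P * 1ℤ)) * (G * (G * 1ℤ))
  square-of-product = solve-∀

odd-valuation-solution : ∀ {p} → Prime p → ∀ a b e B' C' → ¬ (+ p ∣ B') → ¬ (+ p ∣ C') →
  let n = suc (b ℕ.+ b) ; ℓ = suc (a ℕ.+ a) in
  PrimitiveSolution p ((+ p) ^ (n ℕ.+ ℓ ℕ.+ e) * B') ((+ p) ^ ℓ * C') n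
odd-valuation-solution {p} p-prime a b e B' C' p∤B' p∤C'
  with ∃[s]∤s²+p^eB p-prime p∤B' e
... | s , p∤W =
  integral⇒primitiveSolution {p} {q ^ (n ℕ.+ ℓ ℕ.+ e) * B'} {q ^ ℓ * C'} {n}
    (P * (s * u)) u (q * (C' * W))
    (λ (_ , p∣u , _) → p∤u p∣u) (begin
    (P * (s * u)) ^ 2 + (q ^ (n ℕ.+ ℓ ℕ.+ e) * B') * u ^ 2
      ≡⟨ cong (λ t → (P * (s * u)) ^ 2 + (t * B') * u ^ 2) q^[n+ℓ+e]≡P*P*q^e ⟩
    (P * (s * u)) ^ 2 + (P * P * q ^ e * B') * u ^ 2
      ≡⟨ factor-P*P P s u (q ^ e) B' ⟩
    P * P * ((s * u) ^ 2 + (q ^ e * B') * u ^ 2)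
      ≡⟨ cong (P * P *_) (norm-times-square C' s (q ^ e * B') b) ⟩
    P * P * (C' * (C' * W) ^ n)
      ≡⟨ cong (_* (C' * (C' * W) ^ n)) q^n*q^ℓ≡P*P ⟨
    q ^ n * q ^ ℓ * (C' * (C' * W) ^ n)
      ≡⟨ regroup (q ^ n) (q ^ ℓ) C' ((C' * W) ^ n) ⟩
    q ^ ℓ * C' * (q ^ n * (C' * W) ^ n)
      ≡⟨ cong (q ^ ℓ * C' *_) (^-distrib-* q (C' * W) n) ⟨
    q ^ ℓ * C' * (q * (C' * W)) ^ n   ∎)
  where
  open ≡-Reasoning
  q = + p
  n = suc (b ℕ.+ b)
  ℓ = suc (a ℕ.+ a)
  h = suc (a ℕ.+ b)
  P = q ^ h
  W = s ^ 2 + q ^ e * B'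
  u = C' ^ suc b * W ^ b
  p∤u : ¬ (+ p ∣ u)
  p∤u = ∤*∤⇒∤ p-prime {C' ^ suc b} {W ^ b}
          (∤⇒∤^ p-prime {C'} p∤C' (suc b)) (∤⇒∤^ p-prime {W} p∤W b)
  q^[n+ℓ]≡P*P : q ^ (n ℕ.+ ℓ) ≡ P * P
  q^[n+ℓ]≡P*P = trans (cong (q ^_) (odd+odd≡double a b)) (^-distribˡ-+-* q h h)
  q^n*q^ℓ≡P*P : q ^ n * q ^ ℓ ≡ P * P
  q^n*q^ℓ≡P*P = trans (sym (^-distribˡ-+-* q n ℓ)) q^[n+ℓ]≡P*P
  q^[n+ℓ+e]≡P*P*q^e : q ^ (n ℕ.+ ℓ ℕ.+ e) ≡ P * P * q ^ e
  q^[n+ℓ+e]≡P*P*q^e = trans (^-distribˡ-+-* q (n ℕ.+ ℓ) e) (cong (_* q ^ e) q^[n+ℓ]≡P*P)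
  factor-P*P : ∀ P s u E B → (P * (s * u)) * ((P * (s * u)) * 1ℤ) + (P * P * E * B) * (u * (u * 1ℤ))
                           ≡ P * P * ((s * u) * ((s * u) * 1ℤ) + (E * B) * (u * (u * 1ℤ)))
  factor-P*P = solve-∀
  regroup : ∀ N L C Z → N * L * (C * Z) ≡ L * C * (N * Z)
  regroup = solve-∀

lemma3p6 : (n : ℕ) → 3 ≤ n → ¬ (2 ∣ℕ n) →
    (p : ℕ) → Prime p →
    (k ℓ : ℕ) (B' C' : ℤ) → B' ≢ + 0 → C' ≢ + 0 →
    ¬ ((+ p) ∣ (B' * C')) →
    ((2 ∣ℕ ℓ) ⊎ (¬ (2 ∣ℕ ℓ) × n ℕ.+ ℓ ≤ k)) →
    ∃[ x ] ∃[ y ] ∃[ z ]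
    (Primitive p x y z ×
    SolvesIn p ((+ p) ^ k * B') ((+ p) ^ ℓ * C') n x y z)
lemma3p6 n _ 2∤n p p-prime k ℓ B' C' _ _ p∤B'C' valuations with ¬2∣⇒odd n 2∤n | valuations
... | b , refl | inj₁ (divides j refl) =
  even-valuation-solution b k j B' C' (∤*⇒∤ʳ B' C' p∤B'C')
... | b , refl | inj₂ (2∤ℓ , n+ℓ≤k) with ¬2∣⇒odd ℓ 2∤ℓ | ℕ.m≤n⇒∃[o]m+o≡n n+ℓ≤k
...   | a , refl | e , refl =
  odd-valuation-solution p-prime a b e B' C' (∤*⇒∤ˡ B' C' p∤B'C') (∤*⇒∤ʳ B' C' p∤B'C')
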